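{- Let $X=\{a_1,\dots,a_n\}$, let $\mathcal{F}$ be a union-closed family of subsets of $X$ with $\bigcup_{f\in\mathcal{F}}f=X$, and let $w=a_1\cdots a_n$. For $g\in\mathcal{F}$, $\varphi_w(g)=g$ if and only if $g\cup\{a\}\in\mathcal{F}$ for all $a\in X$. Moreover, if $S\subseteq\mathcal{F}$ then $\varphi_w(\mathcal{F})\cap S$ is the set of elements of $S$ fixed by $\varphi_w$.
   Context: Union-closed: $f,g\in\mathcal{F}\Rightarrow f\cup g\in\mathcal{F}$. Rising functions: for $T\subseteq 2^X$ and $a\in X$, $\varphi_{T,a}(z)=z\cup\{a\}$ if $z\cup\{a\}\notin T$, and $\varphi_{T,a}(z)=z$ otherwise. With $\varphi_0=\mathrm{id}$, $\mathcal{F}_0=\mathcal{F}$, $\varphi_j=\varphi_{\mathcal{F}_{j-1},a_j}\circ\varphi_{j-1}$, $\mathcal{F}_j=\varphi_j(\mathcal{F})$ for $1\le j\le n$, the rising function with respect to $w$ is $\varphi_w=\varphi_n:\mathcal{F}\to 2^X$. -}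

module Defs where

open import Data.Nat using (ℕ)
open import Data.Bool using (Bool; if_then_else_) renaming (_≟_ to _≟ᵇ_)
open import Data.Fin using (Fin)
open import Data.Fin.Subset using (Subset; _∪_; ⁅_⁆; ⋃; ⊤)
open import Data.List using (List; []; _∷_; map; allFin)
open import Data.List.Membership.Propositional using (_∈_)
open import Data.Vec.Properties using (≡-dec)
open import Relation.Binary.PropositionalEquality using (_≡_)
open import Relation.Binary.Definitions using (DecidableEquality)
open import Relation.Nullary.Decidable using (does)
open import Function using (_∘_; id)

-- Ground set X = {a₁,…,aₙ} is modelled as Fin n; subsets of X are 'Subset n'.
-- A family of subsets of X is a finite list of subsets (membership via _∈_).

_≟ˢ_ : ∀ {n} → DecidableEquality (Subset n)
_≟ˢ_ = ≡-dec _≟ᵇ_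


UnionClosed : ∀ {n} → List (Subset n) → Set
UnionClosed F = ∀ {f g} → f ∈ F → g ∈ F → (f ∪ g) ∈ F

rise : ∀ {n} → List (Subset n) → Fin n → Subset n → Subset n
rise {n} T a z = if does ((z ∪ ⁅ a ⁆) ∈? T) then z else (z ∪ ⁅ a ⁆)
  where open import Data.List.Membership.DecPropositional (_≟ˢ_ {n}) using (_∈?_)

-- Iteration: given current φ_{j-1} (with F_{j-1} = φ_{j-1}(F)) and the remaining
-- letters of the word, φ_j = φ_{F_{j-1},a_j} ∘ φ_{j-1}.
risingAux : ∀ {n} → List (Subset n) → List (Fin n) → (Subset n → Subset n) → Subset n → Subset n
risingAux F [] φ = φ
risingAux F (a ∷ w) φ = risingAux F w (rise (map φ F) a ∘ φ)

rising : ∀ {n} → List (Subset n) → List (Fin n) → Subset n → Subset n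
rising F w = risingAux F w id

wordAll : ∀ n → List (Fin n)
wordAll n = allFin n

module Submission where

-- Write φ_j for the partial rising maps and F_j = φ_j(F).  Two invariants of
-- the iteration carry the proof.
--
-- * Rising preserves saturated sets (those g ∈ F with g ∪ {a} ∈ F for all a):
--   if every φ_{j-1} fixes them, then so does φ_j, because g ∪ {a_j} is again
--   saturated (union-closedness), hence lies in F_{j-1}, so φ_{F_{j-1},a_j}
--   leaves g in place.  This gives "saturated ⇒ fixed" for every word.
-- * Once the letter a has been processed, every h ∈ F with a ∉ φ_j(h) has a
--   witness k ∈ F with a ∈ k ⊆ φ_j(h) ∪ {a}.  This needs that the maps are
--   extensive and that a not yet processed letter never enters φ_j(h) unless it
--   was already in h; hence the letters of the word must be distinct.
-- For w = a₁⋯aₙ every letter is witnessed, so an image point s = φ_w(h) that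
-- lies in F is saturated: s ∪ {a} = s when a ∈ s, and s ∪ {a} = s ∪ k ∈ F
-- otherwise.  Both parts of the proposition follow.

open import Defs
open import Level using (0ℓ)
open import Data.Nat using (ℕ)
open import Data.Fin using (Fin)
open import Data.Fin.Subset using (Subset; _∪_; ⁅_⁆; ⋃; ⊤)
open import Data.List using (List; map)
open import Data.List.Membership.Propositional using (_∈_)
open import Data.Product using (_×_)
open import Function.Bundles using (_⇔_)
open import Relation.Binary.PropositionalEquality using (_≡_)
open import Relation.Unary using (Pred; _⊆_)

open import Data.Fin.Subset using () renaming (_∈_ to _∈ₛ_; _∉_ to _∉ₛ_; _⊆_ to _⊆ₛ_)
open import Data.Fin.Subset.Properties
  using (⊆-antisym; ⊆-trans; p⊆p∪q; q⊆p∪q; x∈p∪q⁻; x∈⁅x⁆; x∈⁅y⁆⇒x≡y; ∪-assoc)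
  renaming (_∈?_ to _∈ₛ?_)
open import Data.List using ([]; _∷_)
open import Data.List.Membership.Propositional.Properties using (∈-map⁺; ∈-map⁻; ∈-allFin)
open import Data.List.Relation.Unary.Unique.Propositional using (Unique)
open import Data.List.Relation.Unary.Unique.Propositional.Properties using (allFin⁺)
open import Data.List.Relation.Unary.AllPairs using (_∷_)
import Data.List.Relation.Unary.All as All
open import Data.List.Relation.Unary.Any using (here; there)
open import Data.Product using (Σ-syntax; _,_)
open import Data.Sum using (inj₁; inj₂)
open import Data.Empty using (⊥-elim)
open import Relation.Nullary using (¬_; yes; no)
open import Relation.Binary.PropositionalEquality using (refl; sym; subst; cong; module ≡-Reasoning)
open import Function using (_∘_; mk⇔)

module _ {n : ℕ} where

  ∪-least : {p q r : Subset n} → p ⊆ₛ r → q ⊆ₛ r → (p ∪ q) ⊆ₛ r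
  ∪-least {p} {q} p⊆r q⊆r x∈ with x∈p∪q⁻ p q x∈
  ... | inj₁ x∈p = p⊆r x∈p
  ... | inj₂ x∈q = q⊆r x∈q

  ⁅⁆⊆ : {x : Fin n} {p : Subset n} → x ∈ₛ p → ⁅ x ⁆ ⊆ₛ p
  ⁅⁆⊆ {x} x∈p y∈ = subst (_∈ₛ _) (sym (x∈⁅y⁆⇒x≡y x y∈)) x∈p

  ∪⁅⁆-mono : {p q : Subset n} (a : Fin n) → p ⊆ₛ q → (p ∪ ⁅ a ⁆) ⊆ₛ (q ∪ ⁅ a ⁆)
  ∪⁅⁆-mono {q = q} a p⊆q = ∪-least (p⊆p∪q ⁅ a ⁆ ∘ p⊆q) (q⊆p∪q q ⁅ a ⁆)

  ⊆⇒∪≡ : {p q : Subset n} → p ⊆ₛ q → (q ∪ p) ≡ q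
  ⊆⇒∪≡ {p} p⊆q = ⊆-antisym (∪-least (λ x∈ → x∈) p⊆q) (p⊆p∪q p)

  ∪-witness : {a : Fin n} {s k : Subset n} → a ∈ₛ k → k ⊆ₛ (s ∪ ⁅ a ⁆) →
              (s ∪ k) ≡ (s ∪ ⁅ a ⁆)
  ∪-witness {a} {s} {k} a∈k k⊆ =
    ⊆-antisym (∪-least (p⊆p∪q ⁅ a ⁆) k⊆)
              (∪-least (p⊆p∪q k) (⊆-trans (⁅⁆⊆ a∈k) (q⊆p∪q s k)))

  ∪-⁅⁆-merge : (g : Subset n) (b a : Fin n) →
               ((g ∪ ⁅ b ⁆) ∪ (g ∪ ⁅ a ⁆)) ≡ ((g ∪ ⁅ b ⁆) ∪ ⁅ a ⁆)
  ∪-⁅⁆-merge g b a = begin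
    (g ∪ ⁅ b ⁆) ∪ (g ∪ ⁅ a ⁆)  ≡⟨ sym (∪-assoc (g ∪ ⁅ b ⁆) g ⁅ a ⁆) ⟩
    ((g ∪ ⁅ b ⁆) ∪ g) ∪ ⁅ a ⁆  ≡⟨ cong (_∪ ⁅ a ⁆) (⊆⇒∪≡ (p⊆p∪q ⁅ b ⁆)) ⟩
    (g ∪ ⁅ b ⁆) ∪ ⁅ a ⁆        ∎
    where open ≡-Reasoning

  module _ (T : List (Subset n)) (b : Fin n) (z : Subset n) where
    open import Data.List.Membership.DecPropositional (_≟ˢ_ {n}) using () renaming (_∈?_ to _∈L?_)

    rise-extensive : z ⊆ₛ rise T b z
    rise-extensive x∈ with (z ∪ ⁅ b ⁆) ∈L? T
    ... | yes _ = x∈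
    ... | no  _ = p⊆p∪q ⁅ b ⁆ x∈

    rise-bounded : rise T b z ⊆ₛ (z ∪ ⁅ b ⁆)
    rise-bounded x∈ with (z ∪ ⁅ b ⁆) ∈L? T
    ... | yes _ = p⊆p∪q ⁅ b ⁆ x∈
    ... | no  _ = x∈

    rise-blocked : (z ∪ ⁅ b ⁆) ∈ T → rise T b z ≡ z
    rise-blocked z∪b∈T with (z ∪ ⁅ b ⁆) ∈L? T
    ... | yes _ = refl
    ... | no z∪b∉T = ⊥-elim (z∪b∉T z∪b∈T)

    rise-missing : b ∉ₛ rise T b z → (z ∪ ⁅ b ⁆) ∈ T
    rise-missing b∉ with (z ∪ ⁅ b ⁆) ∈L? T
    ... | yes z∪b∈T = z∪b∈T
    ... | no  _     = ⊥-elim (b∉ (q⊆p∪q z ⁅ b ⁆ (x∈⁅x⁆ b)))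

module Rising {n : ℕ} (F : List (Subset n)) where

  riseStep : (Subset n → Subset n) → Fin n → Subset n → Subset n
  riseStep φ b = rise (map φ F) b ∘ φ

  Extensive : (Subset n → Subset n) → Set
  Extensive φ = ∀ z → z ⊆ₛ φ z

  Fresh : Fin n → (Subset n → Subset n) → Set
  Fresh a φ = ∀ {h} → h ∈ F → a ∈ₛ φ h → a ∈ₛ h

  Witnessed : Fin n → (Subset n → Subset n) → Set
  Witnessed a φ = ∀ {h} → h ∈ F → a ∉ₛ φ h →
                  Σ[ k ∈ Subset n ] k ∈ F × a ∈ₛ k × k ⊆ₛ (φ h ∪ ⁅ a ⁆)

  module _ {φ : Subset n → Subset n} (b : Fin n) where

    step-extensive : Extensive φ → Extensive (riseStep φ b)
    step-extensive ext z = rise-extensive (map φ F) b (φ z) ∘ ext z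

    step-fresh : {a : Fin n} → ¬ b ≡ a → Fresh a φ → Fresh a (riseStep φ b)
    step-fresh b≢a fresh h∈F a∈ with x∈p∪q⁻ (φ _) ⁅ b ⁆ (rise-bounded (map φ F) b (φ _) a∈)
    ... | inj₁ a∈φh = fresh h∈F a∈φh
    ... | inj₂ a∈b  = ⊥-elim (b≢a (sym (x∈⁅y⁆⇒x≡y b a∈b)))

    step-keeps-witness : {a : Fin n} → Witnessed a φ → Witnessed a (riseStep φ b)
    step-keeps-witness {a} wit {h} h∈F a∉ with wit h∈F (a∉ ∘ rise-extensive (map φ F) b (φ h))
    ... | k , k∈F , a∈k , k⊆ =
      k , k∈F , a∈k , ⊆-trans k⊆ (∪⁅⁆-mono a (rise-extensive (map φ F) b (φ h)))

    -- Processing a fresh letter b witnesses it: if b stays missing, then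
    -- φ(h) ∪ {b} = φ(k) for some k ∈ F, and freshness puts b into k ⊆ φ(k).
    step-witnesses : Extensive φ → Fresh b φ → Witnessed b (riseStep φ b)
    step-witnesses ext fresh {h} h∈F b∉ with ∈-map⁻ φ (rise-missing (map φ F) b (φ h) b∉)
    ... | k , k∈F , φh∪b≡φk =
      k , k∈F , fresh k∈F b∈φk , ⊆-trans k⊆φh∪b (∪⁅⁆-mono b (rise-extensive (map φ F) b (φ h)))
      where
      k⊆φh∪b : k ⊆ₛ (φ h ∪ ⁅ b ⁆)
      k⊆φh∪b = subst (k ⊆ₛ_) (sym φh∪b≡φk) (ext k)
      b∈φk : b ∈ₛ φ k
      b∈φk = subst (b ∈ₛ_) φh∪b≡φk (q⊆p∪q (φ h) ⁅ b ⁆ (x∈⁅x⁆ b))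

  run-keeps-witness : ∀ w {φ a} → Witnessed a φ → Witnessed a (risingAux F w φ)
  run-keeps-witness []      wit = wit
  run-keeps-witness (b ∷ w) wit = run-keeps-witness w (step-keeps-witness b wit)

  run-witnesses : ∀ w {φ} → Unique w → Extensive φ → (∀ a → a ∈ w → Fresh a φ) →
                  ∀ a → a ∈ w → Witnessed a (risingAux F w φ)
  run-witnesses (b ∷ w) _ ext fresh _ (here refl) =
    run-keeps-witness w (step-witnesses b ext (fresh b (here refl)))
  run-witnesses (b ∷ w) (b∉w ∷ u) ext fresh a (there a∈w) =
    run-witnesses w u (step-extensive b ext) fresh′ a a∈w
    where
    fresh′ : ∀ c → c ∈ w → Fresh c (riseStep _ b)
    fresh′ c c∈w = step-fresh b (All.lookup b∉w c∈w) (fresh c (there c∈w))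

  allWitnessed : ∀ a → Witnessed a (rising F (wordAll n))
  allWitnessed a = run-witnesses (wordAll n) (allFin⁺ n) (λ _ x∈ → x∈) (λ _ _ _ a∈ → a∈) a (∈-allFin a)

  Saturated : Subset n → Set
  Saturated g = ∀ a → (g ∪ ⁅ a ⁆) ∈ F

  module _ (uc : UnionClosed F) where

    saturated-∪ : ∀ {g} → Saturated g → ∀ b → Saturated (g ∪ ⁅ b ⁆)
    saturated-∪ {g} sat b a = subst (_∈ F) (∪-⁅⁆-merge g b a) (uc (sat b) (sat a))

    FixesSaturated : (Subset n → Subset n) → Set
    FixesSaturated φ = ∀ g → Saturated g → φ g ≡ g

    step-fixes-saturated : ∀ {φ} b → FixesSaturated φ → FixesSaturated (riseStep φ b)
    step-fixes-saturated {φ} b fix g sat = begin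
      rise (map φ F) b (φ g)  ≡⟨ cong (rise (map φ F) b) (fix g sat) ⟩
      rise (map φ F) b g      ≡⟨ rise-blocked (map φ F) b g g∪b∈image ⟩
      g                       ∎
      where
      open ≡-Reasoning
      g∪b∈image : (g ∪ ⁅ b ⁆) ∈ map φ F
      g∪b∈image = subst (_∈ map φ F) (fix _ (saturated-∪ sat b)) (∈-map⁺ φ (sat b))

    rising-fixes-saturated : ∀ w → FixesSaturated (rising F w)
    rising-fixes-saturated w = run w (λ _ _ → refl)
      where
      run : ∀ w {φ} → FixesSaturated φ → FixesSaturated (risingAux F w φ)
      run []      fix = fix
      run (b ∷ w) fix = run w (step-fixes-saturated b fix)

    image-saturated : ∀ {h s} → h ∈ F → rising F (wordAll n) h ≡ s → s ∈ F → Saturated s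
    image-saturated {h} {s} h∈F refl s∈F a with a ∈ₛ? s
    ... | yes a∈s = subst (_∈ F) (sym (⊆⇒∪≡ (⁅⁆⊆ a∈s))) s∈F
    ... | no  a∉s with allWitnessed a h∈F a∉s
    ...   | k , k∈F , a∈k , k⊆ = subst (_∈ F) (∪-witness a∈k k⊆) (uc s∈F k∈F)

proposition3p7 : (n : ℕ) (F : List (Subset n)) → UnionClosed F → ⋃ F ≡ ⊤ →
    ((g : Subset n) → g ∈ F →
    (rising F (wordAll n) g ≡ g ⇔ ((a : Fin n) → (g ∪ ⁅ a ⁆) ∈ F)))
    × ((S : Pred (Subset n) 0ℓ) → S ⊆ (λ h → h ∈ F) → (s : Subset n) →
    ((s ∈ map (rising F (wordAll n)) F × S s) ⇔ (S s × rising F (wordAll n) s ≡ s)))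
proposition3p7 n F uc _ = fixedIffSaturated , imageMeetsS
  where
  open Rising F
  φw = rising F (wordAll n)

  fixedIffSaturated : (g : Subset n) → g ∈ F → (φw g ≡ g ⇔ Saturated g)
  fixedIffSaturated g g∈F =
    mk⇔ (λ fixed → image-saturated uc g∈F fixed g∈F) (rising-fixes-saturated uc (wordAll n) g)

  imageMeetsS : (S : Pred (Subset n) 0ℓ) → S ⊆ (λ h → h ∈ F) → (s : Subset n) →
                ((s ∈ map φw F × S s) ⇔ (S s × φw s ≡ s))
  imageMeetsS S S⊆F s = mk⇔ toFixed toImage
    where
    toFixed : s ∈ map φw F × S s → S s × φw s ≡ s
    toFixed (s∈image , Ss) with ∈-map⁻ φw s∈image
    ... | h , h∈F , s≡φwh =
      Ss , rising-fixes-saturated uc (wordAll n) s (image-saturated uc h∈F (sym s≡φwh) (S⊆F Ss))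
    toImage : S s × φw s ≡ s → s ∈ map φw F × S s
    toImage (Ss , fixed) = subst (_∈ map φw F) fixed (∈-map⁺ φw (S⊆F Ss)) , Ss
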